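{- Let $r$ be a positive integer, let $s,t$ be integers with $0\le s,t\le r-1$, and let $h$ be a positive integer with $r<\phi^h$. Then there exists a Hofstadter G pair $(u,v)$ with $u\equiv s\pmod r$, $v\equiv t\pmod r$, and $v\le F_{2h+2}-2$.
   Context: $F_0=0$, $F_1=1$, $F_i=F_{i-1}+F_{i-2}$ are the Fibonacci numbers and $\phi=(1+\sqrt5)/2$. Hofstadter's G function is $G(x)=\lfloor\phi^{ -1}(x+1)\rfloor$ for integers $x\ge0$ (equivalently $G(0)=0$, $G(1)=1$, $G(x)=x-G(G(x-1))$). A Hofstadter G pair is a pair $(u,v)$ of positive integers with $u=G(v)$. -}

module Defs where

open import Data.Nat using (ℕ; zero; suc; _+_; _*_; _∸_; _<_; _≤_)
open import Relation.Binary.PropositionalEquality using (_≡_)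
open import Data.Product using (_×_)

F : ℕ → ℕ
F zero = 0
F (suc zero) = 1
F (suc (suc i)) = F (suc i) + F i

-- Hofstadter G via G(0)=0, G(1)=1, G(x)=x-G(G(x-1)), computed with fuel.
-- Gfuel f x is correct whenever f ≥ x + 1 (recursive calls are on values ≤ x-1).
Gfuel : ℕ → ℕ → ℕ
Gfuel zero _ = 0
Gfuel (suc f) zero = 0
Gfuel (suc f) (suc zero) = 1
Gfuel (suc f) (suc (suc x)) = suc (suc x) ∸ Gfuel f (Gfuel f (suc x))

G : ℕ → ℕ
G x = Gfuel (suc x) x

GPair : ℕ → ℕ → Set
GPair u v = (1 ≤ u) × (1 ≤ v) × (u ≡ G v)

-- LtPhiPow r h  encodes the real inequality  r < φ^h  exactly.
-- φ^0 = 1.  For h = k+1:  φ^h = (L + F_h √5)/2  with  L = F_{k+1} + 2 F_k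
-- (the Lucas number), so  r < φ^h  ⇔  2r - L < F_h √5, and since F_h > 0
-- this is  (max(2r - L, 0))^2 < 5 F_h^2.
LtPhiPow : ℕ → ℕ → Set
LtPhiPow r zero = r < 1
LtPhiPow r (suc k) =
  let d = (2 * r) ∸ (F (suc k) + 2 * F k) in d * d < 5 * (F (suc k) * F (suc k))

{-# OPTIONS --safe #-}
module Submission where

open import Defs
open import Data.Nat using (ℕ; _<_; _≤_; _+_; _*_; _∸_; NonZero)
open import Data.Nat.DivMod using (_%_)
open import Data.Product using (Σ; _×_)
open import Relation.Binary.PropositionalEquality using (_≡_)
open import Data.Nat using (zero; suc; z≤n; s≤s; pred; _≟_; _<?_; _≤?_; >-nonZero; >-nonZero⁻¹)
open import Data.Nat.Properties
open import Data.Nat.DivMod using (_/_; %-distribˡ-+; [m+kn]%n≡m%n; m≡m%n+[m/n]*n; m%n<n; m<n⇒m%n≡m)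
open import Data.Nat.Induction using (<-rec)
open import Data.Nat.Tactic.RingSolver using (solve-∀; solve)
open import Data.List using (_∷_; [])
open import Data.Product using (_,_; proj₁; proj₂)
open import Data.Sum using (_⊎_; inj₁; inj₂; [_,_]′)
open import Data.Empty using (⊥-elim)
open import Function using (_∘_)
open import Relation.Nullary using (¬_; yes; no)
open import Relation.Binary using (tri<; tri≈; tri>)
open import Relation.Binary.PropositionalEquality using (refl; sym; trans; cong; cong₂; subst)
open ≤-Reasoning

-- Write h = k + 1 and (a, p, q) = (F k, F (k + 1), F (k + 2)), and put
-- P = F (2h + 1), Q = F (2h), R = F (2h − 1), so that P = Q + R and Q² + 1 = PR.
-- For such a triple G v = ⌊(v + 1)Q/P⌋ whenever v < P + Q = F (2h + 2), because
-- Cassini's identity makes the floor expression obey G v = v − G (G (v − 1)).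
-- The residues jQ mod P with j < p + q meet every window of q consecutive
-- residues, and r < φ^h gives r ≤ p + 2a (the Lucas number L_h), hence rq ≤ P:
-- so j can be chosen with ⌊(v + 1)Q/P⌋ ≡ s (mod r) for v = t + rj < P + Q.
-- For s = t = 0 the pair is an explicit multiple of (p, q), resp. (q, p + q).

infix 4 _≡⌊_/_⌋

_≡⌊_/_⌋ : ℕ → ℕ → ℕ → Set
u ≡⌊ x / d ⌋ = Σ ℕ λ ρ → u * d + ρ ≡ x × ρ < d

quotient-<-mono : ∀ {u u′ ρ ρ′ d} → u < u′ → ρ < d → u * d + ρ < u′ * d + ρ′
quotient-<-mono {u} {u′} {ρ} {ρ′} {d} u<u′ ρ<d = begin-strict
  u * d + ρ   <⟨ +-monoʳ-< (u * d) ρ<d ⟩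
  u * d + d   ≡⟨ +-comm (u * d) d ⟩
  suc u * d   ≤⟨ *-monoˡ-≤ d u<u′ ⟩
  u′ * d      ≤⟨ m≤m+n (u′ * d) ρ′ ⟩
  u′ * d + ρ′ ∎

⌊/⌋-unique : ∀ {u u′ x d} → u ≡⌊ x / d ⌋ → u′ ≡⌊ x / d ⌋ → u ≡ u′
⌊/⌋-unique {u} {u′} (ρ , eq , ρ<d) (ρ′ , eq′ , ρ′<d) with <-cmp u u′
... | tri< u<u′ _ _ = ⊥-elim (<-irrefl (trans eq (sym eq′)) (quotient-<-mono u<u′ ρ<d))
... | tri≈ _ u≡u′ _ = u≡u′
... | tri> _ _ u′<u = ⊥-elim (<-irrefl (trans eq′ (sym eq)) (quotient-<-mono u′<u ρ′<d))

⌊/⌋-∸ : ∀ {w x m d} → w ≡⌊ x + m * d / d ⌋ → Σ ℕ λ u → u + m ≡ w × u ≡⌊ x / d ⌋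
⌊/⌋-∸ {w} {x} {m} {d} (ρ , eq , ρ<d) = w ∸ m , m∸n+n≡m m≤w , ρ , remainder , ρ<d
  where
  m≤w : m ≤ w
  m≤w = ≮⇒≥ λ w<m → <-irrefl (trans eq (+-comm x (m * d))) (quotient-<-mono w<m ρ<d)
  remainder : (w ∸ m) * d + ρ ≡ x
  remainder = +-cancelʳ-≡ (m * d) _ x (begin-equality
    (w ∸ m) * d + ρ + m * d ≡⟨ regroup (w ∸ m) ρ m d ⟩
    ((w ∸ m) + m) * d + ρ   ≡⟨ cong (λ y → y * d + ρ) (m∸n+n≡m m≤w) ⟩
    w * d + ρ               ≡⟨ eq ⟩
    x + m * d               ∎)
    where
    regroup : ∀ u ρ m d → u * d + ρ + m * d ≡ (u + m) * d + ρ
    regroup = solve-∀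

⌊/⌋-positive : ∀ {u x d} → u ≡⌊ x / d ⌋ → d ≤ x → 1 ≤ u
⌊/⌋-positive {zero} (ρ , ρ≡x , ρ<d) d≤x =
  ⊥-elim (<-irrefl refl (<-≤-trans ρ<d (subst (_ ≤_) (sym ρ≡x) d≤x)))
⌊/⌋-positive {suc u} _ _ = s≤s z≤n
offset-quotient-≡ : ∀ {T U d x y} → T + x * d ≡ U + y * d → U < d → T < U + d → x ≡ y
offset-quotient-≡ {T} {U} {d} {x} {y} eq U<d T<U+d with <-cmp x y
... | tri≈ _ x≡y _ = x≡y
... | tri< x<y _ _ = ⊥-elim (<-irrefl eq (begin-strict
      T + x * d       <⟨ +-monoˡ-< (x * d) T<U+d ⟩
      U + d + x * d   ≡⟨ +-assoc U d (x * d) ⟩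
      U + suc x * d   ≤⟨ +-monoʳ-≤ U (*-monoˡ-≤ d x<y) ⟩
      U + y * d       ∎))
... | tri> _ _ y<x = ⊥-elim (<-irrefl (sym eq) (begin-strict
      U + y * d       <⟨ +-monoˡ-< (y * d) U<d ⟩
      suc y * d       ≤⟨ *-monoˡ-≤ d y<x ⟩
      x * d           ≤⟨ m≤n+m (x * d) T ⟩
      T + x * d       ∎))

offset-quotient-suc : ∀ {T U d x y} → T + x * d ≡ U + y * d → U < T → T < U + (d + d) → y ≡ suc x
offset-quotient-suc {T} {U} {d} {x} {y} eq U<T T<U+2d with <-cmp y (suc x)
... | tri≈ _ y≡1+x _ = y≡1+x
... | tri< y<1+x _ _ = ⊥-elim (<-irrefl (sym eq) (begin-strict
      U + y * d       ≤⟨ +-monoʳ-≤ U (*-monoˡ-≤ d (≤-pred y<1+x)) ⟩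
      U + x * d       <⟨ +-monoˡ-< (x * d) U<T ⟩
      T + x * d       ∎))
... | tri> _ _ 1+x<y = ⊥-elim (<-irrefl eq (begin-strict
      T + x * d             <⟨ +-monoˡ-< (x * d) T<U+2d ⟩
      U + (d + d) + x * d   ≡⟨ regroup U d x ⟩
      U + suc (suc x) * d   ≤⟨ +-monoʳ-≤ U (*-monoˡ-≤ d 1+x<y) ⟩
      U + y * d             ∎))
  where
  regroup : ∀ U d x → U + (d + d) + x * d ≡ U + suc (suc x) * d
  regroup = solve-∀

%-≡⇒offset : ∀ {x y d} .{{_ : NonZero d}} → x % d ≡ y % d → x + y / d * d ≡ y + x / d * d
%-≡⇒offset {x} {y} {d} x≈y = begin-equality
  x + y / d * d                   ≡⟨ cong (_+ y / d * d) (m≡m%n+[m/n]*n x d) ⟩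
  x % d + x / d * d + y / d * d   ≡⟨ cong (λ ρ → ρ + x / d * d + y / d * d) x≈y ⟩
  y % d + x / d * d + y / d * d   ≡⟨ swap (y % d) (x / d * d) (y / d * d) ⟩
  y % d + y / d * d + x / d * d   ≡⟨ cong (_+ x / d * d) (sym (m≡m%n+[m/n]*n y d)) ⟩
  y + x / d * d                   ∎
  where
  swap : ∀ a b c → a + b + c ≡ a + c + b
  swap = solve-∀

+-*-≡⇒%-≡ : ∀ {x y a b r} .{{_ : NonZero r}} → x + r * a ≡ y + r * b → x % r ≡ y % r
+-*-≡⇒%-≡ {x} {y} {a} {b} {r} eq = begin-equality
  x % r             ≡⟨ sym ([m+kn]%n≡m%n x a r) ⟩
  (x + a * r) % r   ≡⟨ cong (λ z → (x + z) % r) (*-comm a r) ⟩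
  (x + r * a) % r   ≡⟨ cong (_% r) eq ⟩
  (y + r * b) % r   ≡⟨ cong (λ z → (y + z) % r) (*-comm r b) ⟩
  (y + b * r) % r   ≡⟨ [m+kn]%n≡m%n y b r ⟩
  y % r             ∎

overshoot : ∀ {W B} r .{{_ : NonZero r}} → W ≤ B → Σ ℕ λ z → Σ ℕ λ e → W + r * z ≡ B + e × e < r
overshoot {W} {B} r W≤B = z , pred r ∸ m , W+rz≡B+e , ≤-<-trans (m∸n≤m (pred r) m) pred[r]<r
  where
  N = (B ∸ W) + pred r
  z = N / r
  m = N % r
  pred[r]<r : pred r < r
  pred[r]<r = subst (pred r <_) (suc-pred r) ≤-refl
  W+rz≡B+e : W + r * z ≡ B + (pred r ∸ m)
  W+rz≡B+e = +-cancelʳ-≡ m _ _ (begin-equality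
    W + r * z + m               ≡⟨ regroup W r z m ⟩
    W + (m + z * r)             ≡⟨ cong (W +_) (sym (m≡m%n+[m/n]*n N r)) ⟩
    W + ((B ∸ W) + pred r)      ≡⟨ sym (+-assoc W (B ∸ W) (pred r)) ⟩
    W + (B ∸ W) + pred r        ≡⟨ cong (_+ pred r) (m+[n∸m]≡n W≤B) ⟩
    B + pred r                  ≡⟨ cong (B +_) (sym (m∸n+n≡m (<⇒≤pred (m%n<n N r)))) ⟩
    B + (pred r ∸ m + m)        ≡⟨ sym (+-assoc B (pred r ∸ m) m) ⟩
    B + (pred r ∸ m) + m        ∎)
    where
    regroup : ∀ W r z m → W + r * z + m ≡ W + (m + z * r)
    regroup = solve-∀

Gfuel-≤ : ∀ f x → Gfuel f x ≤ x
Gfuel-≤ zero          x             = z≤n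
Gfuel-≤ (suc f)       zero          = z≤n
Gfuel-≤ (suc f)       (suc zero)    = ≤-refl
Gfuel-≤ (suc f)       (suc (suc x)) = m∸n≤m (suc (suc x)) (Gfuel f (Gfuel f (suc x)))

Gfuel-irrelevant : ∀ f g x → x < f → x < g → Gfuel f x ≡ Gfuel g x
Gfuel-irrelevant (suc f) (suc g) zero          _          _          = refl
Gfuel-irrelevant (suc f) (suc g) (suc zero)    _          _          = refl
Gfuel-irrelevant (suc f) (suc g) (suc (suc x)) (s≤s x<f) (s≤s x<g) =
  cong (suc (suc x) ∸_) (trans (cong (Gfuel f) (Gfuel-irrelevant f g (suc x) x<f x<g))
    (Gfuel-irrelevant f g _ (≤-<-trans (Gfuel-≤ g (suc x)) x<f) (≤-<-trans (Gfuel-≤ g (suc x)) x<g)))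

G-≤ : ∀ x → G x ≤ x
G-≤ x = Gfuel-≤ (suc x) x

G-suc-suc : ∀ x → G (suc (suc x)) ≡ suc (suc x) ∸ G (G (suc x))
G-suc-suc x = cong (suc (suc x) ∸_)
  (Gfuel-irrelevant (suc (suc x)) (suc (G (suc x))) (G (suc x)) (s≤s (G-≤ (suc x))) ≤-refl)

WindowCover : (P Q n w : ℕ) .{{_ : NonZero P}} → Set
WindowCover P Q n w = ∀ z → Σ ℕ λ j → Σ ℕ λ k → j < n × k < w × (j * Q) % P ≡ (z + k) % P

-- j ↦ j + p (as +p or −q) rotates {0, …, p + q − 1} while S grows by q or p;
-- as S moves by at most q per step it meets every window of q integers.
module Walk {P : ℕ} {{_ : NonZero P}} (Q p q : ℕ) (1≤p : 1 ≤ p) (p≤q : p ≤ q) where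

  infix 4 _≈_
  _≈_ : ℕ → ℕ → Set
  x ≈ y = x % P ≡ y % P

  +-cong : ∀ {x y u w} → x ≈ y → u ≈ w → x + u ≈ y + w
  +-cong {x} {y} {u} {w} x≈y u≈w = begin-equality
    (x + u) % P             ≡⟨ %-distribˡ-+ x u P ⟩
    (x % P + u % P) % P     ≡⟨ cong₂ (λ a b → (a + b) % P) x≈y u≈w ⟩
    (y % P + w % P) % P     ≡⟨ sym (%-distribˡ-+ y w P) ⟩
    (y + w) % P             ∎

  step : ℕ × ℕ → ℕ × ℕ
  step (j , S) with j <? q
  ... | yes _ = j + p , S + q
  ... | no  _ = j ∸ q , S + p

  walk : ℕ → ℕ × ℕ
  walk zero    = 0 , 0
  walk (suc n) = step (walk n)

  index total : ℕ → ℕ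
  index n = proj₁ (walk n)
  total n = proj₂ (walk n)

  step-index-< : ∀ j S → j < p + q → proj₁ (step (j , S)) < p + q
  step-index-< j S j<p+q with j <? q
  ... | yes j<q = subst (j + p <_) (+-comm q p) (+-monoˡ-< p j<q)
  ... | no  _   = ≤-<-trans (m∸n≤m j q) j<p+q

  step-total : ∀ j S → S < proj₂ (step (j , S)) × proj₂ (step (j , S)) ≤ S + q
  step-total j S with j <? q
  ... | yes _ = m<m+n S (≤-trans 1≤p p≤q) , ≤-refl
  ... | no  _ = m<m+n S 1≤p , +-monoʳ-≤ S p≤q

  index-< : ∀ n → index n < p + q
  index-< zero    = ≤-trans 1≤p (m≤m+n p q)
  index-< (suc n) = step-index-< (index n) (total n) (index-< n)

  n≤total : ∀ n → n ≤ total n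
  n≤total zero    = z≤n
  n≤total (suc n) = ≤-<-trans (n≤total n) (proj₁ (step-total (index n) (total n)))

  last-below : ∀ {Y} N → 0 < Y → Y ≤ total N → Σ ℕ λ n → total n < Y × Y ≤ total (suc n)
  last-below zero    0<Y Y≤0 = ⊥-elim (<-irrefl refl (<-≤-trans 0<Y Y≤0))
  last-below {Y} (suc N) 0<Y Y≤total[1+N] with Y ≤? total N
  ... | yes Y≤total[N] = last-below N 0<Y Y≤total[N]
  ... | no  Y≰total[N] = N , ≰⇒> Y≰total[N] , Y≤total[1+N]

  crossing : ∀ Y → 0 < Y → Σ ℕ λ n → total n < Y × Y ≤ total n + q
  crossing Y 0<Y with last-below Y 0<Y (n≤total Y)
  ... | n , total[n]<Y , Y≤total[1+n] =
    n , total[n]<Y , ≤-trans Y≤total[1+n] (proj₂ (step-total (index n) (total n)))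

  ∸-*-+ : ∀ {j c} → q ≤ j → (j ∸ q) * Q + (q * Q + c) ≡ j * Q + c
  ∸-*-+ {j} {c} q≤j = begin-equality
    (j ∸ q) * Q + (q * Q + c) ≡⟨ sym (+-assoc ((j ∸ q) * Q) (q * Q) c) ⟩
    (j ∸ q) * Q + q * Q + c   ≡⟨ cong (_+ c) (sym (*-distribʳ-+ Q (j ∸ q) q)) ⟩
    ((j ∸ q) + q) * Q + c     ≡⟨ cong (λ y → y * Q + c) (m∸n+n≡m q≤j) ⟩
    j * Q + c                 ∎

  -- Moving j by +p or −q changes jQ by pQ ≡ q or by −qQ ≡ p, the step of S.
  module _ (pQ≈q : p * Q ≈ q) (qQ+p≈0 : q * Q + p ≈ 0) where

    index*Q≈total : ∀ n → index n * Q ≈ total n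
    index*Q≈total zero    = refl
    index*Q≈total (suc n) = preserved (index n) (total n) (index*Q≈total n)
      where
      preserved : ∀ j S → j * Q ≈ S → proj₁ (step (j , S)) * Q ≈ proj₂ (step (j , S))
      preserved j S jQ≈S with j <? q
      ... | yes _   = begin-equality
        ((j + p) * Q) % P           ≡⟨ cong (_% P) (*-distribʳ-+ Q j p) ⟩
        (j * Q + p * Q) % P         ≡⟨ +-cong jQ≈S pQ≈q ⟩
        (S + q) % P                 ∎
      ... | no j≮q = begin-equality
        ((j ∸ q) * Q) % P           ≡⟨ cong (_% P) (sym (+-identityʳ _)) ⟩
        ((j ∸ q) * Q + 0) % P       ≡⟨ +-cong {(j ∸ q) * Q} refl (sym qQ+p≈0) ⟩
        ((j ∸ q) * Q + (q * Q + p)) % P ≡⟨ cong (_% P) (∸-*-+ (≮⇒≥ j≮q)) ⟩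
        (j * Q + p) % P             ≡⟨ +-cong jQ≈S (refl {x = p % P}) ⟩
        (S + p) % P                 ∎

    window-cover₊ : WindowCover P Q (p + q) q
    window-cover₊ z with crossing (z + q) (≤-trans (≤-trans 1≤p p≤q) (m≤n+m q z))
    ... | n , total[n]<z+q , z+q≤total[n]+q =
      index n , total n ∸ z , index-< n , k<q , subst (index n * Q ≈_) (sym z+k≡total) (index*Q≈total n)
      where
      z≤total : z ≤ total n
      z≤total = +-cancelʳ-≤ q z (total n) z+q≤total[n]+q
      z+k≡total : z + (total n ∸ z) ≡ total n
      z+k≡total = m+[n∸m]≡n z≤total
      k<q : total n ∸ z < q
      k<q = +-cancelˡ-< z (total n ∸ z) q (subst (_< z + q) (sym z+k≡total) total[n]<z+q)

  -- Now the same moves change jQ by −q or −p, so jQ + S is invariant.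
  module _ (pQ+q≈0 : p * Q + q ≈ 0) (qQ≈p : q * Q ≈ p) where

    index*Q+total≈0 : ∀ n → index n * Q + total n ≈ 0
    index*Q+total≈0 zero    = refl
    index*Q+total≈0 (suc n) = preserved (index n) (total n) (index*Q+total≈0 n)
      where
      preserved : ∀ j S → j * Q + S ≈ 0 → proj₁ (step (j , S)) * Q + proj₂ (step (j , S)) ≈ 0
      preserved j S jQ+S≈0 with j <? q
      ... | yes _   = begin-equality
        ((j + p) * Q + (S + q)) % P     ≡⟨ cong (_% P) (regroup j p Q S q) ⟩
        ((j * Q + S) + (p * Q + q)) % P ≡⟨ +-cong jQ+S≈0 pQ+q≈0 ⟩
        0 % P                           ∎
        where
        regroup : ∀ j p Q S q → (j + p) * Q + (S + q) ≡ (j * Q + S) + (p * Q + q)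
        regroup = solve-∀
      ... | no j≮q = begin-equality
        ((j ∸ q) * Q + (S + p)) % P       ≡⟨ +-cong {(j ∸ q) * Q} refl (+-cong {S} refl (sym qQ≈p)) ⟩
        ((j ∸ q) * Q + (S + q * Q)) % P   ≡⟨ cong (λ y → ((j ∸ q) * Q + y) % P) (+-comm S (q * Q)) ⟩
        ((j ∸ q) * Q + (q * Q + S)) % P   ≡⟨ cong (_% P) (∸-*-+ (≮⇒≥ j≮q)) ⟩
        (j * Q + S) % P                   ≡⟨ jQ+S≈0 ⟩
        0 % P                             ∎

    -- Z = z(P − 1) ≡ −z, so jQ ≡ −S = (Z − S) − Z ≡ k + z.
    window-cover₋ : WindowCover P Q (p + q) q
    window-cover₋ z with crossing (suc (z * pred P)) (s≤s z≤n)
    ... | n , total[n]<1+Z , 1+Z≤total[n]+q =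
      index n , k , index-< n , k<q , jQ≈z+k
      where
      Z = z * pred P
      j = index n
      S = total n
      k = Z ∸ S
      S+k≡Z : S + k ≡ Z
      S+k≡Z = m+[n∸m]≡n (≤-pred total[n]<1+Z)
      k<q : k < q
      k<q = +-cancelˡ-< S k q (subst (_≤ S + q) (cong suc (sym S+k≡Z)) 1+Z≤total[n]+q)
      zP≡S+k+z : z * P ≡ S + k + z
      zP≡S+k+z = begin-equality
        z * P             ≡⟨ cong (z *_) (sym (suc-pred P)) ⟩
        z * suc (pred P)  ≡⟨ *-suc z (pred P) ⟩
        z + Z             ≡⟨ +-comm z Z ⟩
        Z + z             ≡⟨ cong (_+ z) (sym S+k≡Z) ⟩
        S + k + z         ∎
      jQ≈z+k : j * Q ≈ z + k
      jQ≈z+k = begin-equality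
        (j * Q) % P                 ≡⟨ sym ([m+kn]%n≡m%n (j * Q) z P) ⟩
        (j * Q + z * P) % P         ≡⟨ cong (λ y → (j * Q + y) % P) zP≡S+k+z ⟩
        (j * Q + (S + k + z)) % P   ≡⟨ cong (_% P) (regroup (j * Q) S k z) ⟩
        ((j * Q + S) + (z + k)) % P ≡⟨ +-cong {j * Q + S} (index*Q+total≈0 n) refl ⟩
        (0 + (z + k)) % P           ∎
        where
        regroup : ∀ a S k z → a + (S + k + z) ≡ (a + S) + (z + k)
        regroup = solve-∀

-- Pick z with (1 + t)Q + rz just above (s + r)P
-- and j with jQ ≡ z + k (mod P); then, up to a multiple of rP, the number lies
-- e + rk < P above (s + r(1 + β))P, so its quotient by P is ≡ s (mod r).
lift-residue : ∀ {P Q M w r s t} .{{_ : NonZero P}} .{{_ : NonZero r}} →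
  WindowCover P Q M w → Q ≤ P → r * w ≤ P → s < r → t < r →
  Σ ℕ λ j → j < M × Σ ℕ λ u → u % r ≡ s % r × u ≡⌊ suc (t + r * j) * Q / P ⌋
lift-residue {P} {Q} {M} {w} {r} {s} {t} cover Q≤P rw≤P s<r t<r
  with overshoot {suc t * Q} {(s + r) * P} r W≤B
  where
  W≤B : suc t * Q ≤ (s + r) * P
  W≤B = begin
    suc t * Q   ≤⟨ *-mono-≤ t<r Q≤P ⟩
    r * P       ≤⟨ *-monoˡ-≤ P (m≤n+m r s) ⟩
    (s + r) * P ∎
... | z , e , W+rz≡B+e , e<r with cover z
... | j , k , j<M , k<w , jQ≈z+k with ⌊/⌋-∸ (e + r * k , X+rαP≡ , e+rk<P)
  where
  α = (z + k) / P
  β = (j * Q) / P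
  X+rαP≡ : (s + r * suc β) * P + (e + r * k) ≡ suc (t + r * j) * Q + r * α * P
  X+rαP≡ = sym (begin-equality
    suc (t + r * j) * Q + r * α * P          ≡⟨ regroup₁ t r j Q α P ⟩
    suc t * Q + r * (j * Q + α * P)          ≡⟨ cong (λ y → suc t * Q + r * y) (%-≡⇒offset jQ≈z+k) ⟩
    suc t * Q + r * (z + k + β * P)          ≡⟨ regroup₂ (suc t * Q) r z k β P ⟩
    suc t * Q + r * z + (r * k + r * β * P)  ≡⟨ cong (_+ (r * k + r * β * P)) W+rz≡B+e ⟩
    (s + r) * P + e + (r * k + r * β * P)    ≡⟨ regroup₃ s r P e k β ⟩
    (s + r * suc β) * P + (e + r * k)        ∎)
    where
    regroup₁ : ∀ t r j Q α P → suc (t + r * j) * Q + r * α * P ≡ suc t * Q + r * (j * Q + α * P)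
    regroup₁ = solve-∀
    regroup₂ : ∀ W r z k β P → W + r * (z + k + β * P) ≡ W + r * z + (r * k + r * β * P)
    regroup₂ = solve-∀
    regroup₃ : ∀ s r P e k β → (s + r) * P + e + (r * k + r * β * P) ≡ (s + r * suc β) * P + (e + r * k)
    regroup₃ = solve-∀
  e+rk<P : e + r * k < P
  e+rk<P = begin-strict
    e + r * k   <⟨ +-monoˡ-< (r * k) e<r ⟩
    r + r * k   ≡⟨ sym (*-suc r k) ⟩
    r * suc k   ≤⟨ *-monoʳ-≤ r k<w ⟩
    r * w       ≤⟨ rw≤P ⟩
    P           ∎
... | u , u+rα≡s+r[1+β] , u≡⌊X/P⌋ = j , j<M , u , +-*-≡⇒%-≡ u+rα≡s+r[1+β] , u≡⌊X/P⌋

GPairWithResidues : (r : ℕ) .{{_ : NonZero r}} (s t B : ℕ) → Set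
GPairWithResidues r s t B =
  Σ ℕ λ u → Σ ℕ λ v → GPair u v × u % r ≡ s % r × v % r ≡ t % r × v ≤ B ∸ 2

module CassiniTriple {P Q R : ℕ} (P≡Q+R : P ≡ Q + R) (cassini : Q * Q + 1 ≡ P * R)
                     (R≤Q : R ≤ Q) (1≤R : 1 ≤ R) where

  Q<P : Q < P
  Q<P = begin-strict
    Q     <⟨ m<m+n Q 1≤R ⟩
    Q + R ≡⟨ sym P≡Q+R ⟩
    P     ∎

  instance
    P-nonZero : NonZero P
    P-nonZero = >-nonZero (≤-<-trans z≤n Q<P)

  R[P+Q]≡QP+1 : R * (P + Q) ≡ Q * P + 1
  R[P+Q]≡QP+1 = begin-equality
    R * (P + Q)       ≡⟨ solve (R ∷ P ∷ Q ∷ []) ⟩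
    P * R + R * Q     ≡⟨ cong (_+ R * Q) (sym cassini) ⟩
    Q * Q + 1 + R * Q ≡⟨ solve (Q ∷ R ∷ []) ⟩
    Q * (Q + R) + 1   ≡⟨ cong (λ y → Q * y + 1) (sym P≡Q+R) ⟩
    Q * P + 1         ∎

  -- With a = ⌊vQ/P⌋ and b = ⌊(a+1)Q/P⌋, Cassini makes κ = vR − aQ satisfy
  -- κP = ρQ + v; summing the division identities gives balance, and
  -- v − b is a or a + 1 according as ρ < R or not.
  module Step {v a b ρ σ : ℕ} (v<P+Q : v < P + Q)
              (aP+ρ≡vQ : a * P + ρ ≡ v * Q) (ρ<P : ρ < P)
              (bP+σ≡[1+a]Q : b * P + σ ≡ suc a * Q) (σ<P : σ < P) where

    vRP≡aQP+ρQ+v : v * R * P ≡ a * Q * P + (ρ * Q + v)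
    vRP≡aQP+ρQ+v = begin-equality
      v * R * P             ≡⟨ solve (v ∷ R ∷ P ∷ []) ⟩
      v * (P * R)           ≡⟨ cong (v *_) (sym cassini) ⟩
      v * (Q * Q + 1)       ≡⟨ solve (v ∷ Q ∷ []) ⟩
      v * Q * Q + v         ≡⟨ cong (λ y → y * Q + v) (sym aP+ρ≡vQ) ⟩
      (a * P + ρ) * Q + v   ≡⟨ solve (a ∷ P ∷ ρ ∷ Q ∷ v ∷ []) ⟩
      a * Q * P + (ρ * Q + v) ∎

    κ : ℕ
    κ = v * R ∸ a * Q

    κ+aQ≡vR : κ + a * Q ≡ v * R
    κ+aQ≡vR = m∸n+n≡m (*-cancelʳ-≤ (a * Q) (v * R) P
      (subst (a * Q * P ≤_) (sym vRP≡aQP+ρQ+v) (m≤m+n (a * Q * P) (ρ * Q + v))))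

    κP≡ρQ+v : κ * P ≡ ρ * Q + v
    κP≡ρQ+v = +-cancelˡ-≡ (a * Q * P) (κ * P) (ρ * Q + v) (begin-equality
      a * Q * P + κ * P ≡⟨ +-comm (a * Q * P) (κ * P) ⟩
      κ * P + a * Q * P ≡⟨ sym (*-distribʳ-+ P κ (a * Q)) ⟩
      (κ + a * Q) * P   ≡⟨ cong (_* P) κ+aQ≡vR ⟩
      v * R * P         ≡⟨ vRP≡aQP+ρQ+v ⟩
      a * Q * P + (ρ * Q + v) ∎)

    [κ+ρ]P≡ρ[P+Q]+v : (κ + ρ) * P ≡ ρ * (P + Q) + v
    [κ+ρ]P≡ρ[P+Q]+v = begin-equality
      (κ + ρ) * P       ≡⟨ *-distribʳ-+ P κ ρ ⟩
      κ * P + ρ * P     ≡⟨ cong (_+ ρ * P) κP≡ρQ+v ⟩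
      ρ * Q + v + ρ * P ≡⟨ regroup ρ Q v P ⟩
      ρ * (P + Q) + v   ∎
      where
      regroup : ∀ ρ Q v P → ρ * Q + v + ρ * P ≡ ρ * (P + Q) + v
      regroup = solve-∀

    balance : σ + (κ + ρ) + (a + b) * P ≡ Q + v * P
    balance = begin-equality
      σ + (κ + ρ) + (a + b) * P     ≡⟨ regroup₁ σ κ ρ a b P ⟩
      (b * P + σ) + (a * P + ρ) + κ ≡⟨ cong₂ (λ x y → x + y + κ) bP+σ≡[1+a]Q aP+ρ≡vQ ⟩
      suc a * Q + v * Q + κ         ≡⟨ regroup₂ a Q v κ ⟩
      Q + v * Q + (κ + a * Q)       ≡⟨ cong (Q + v * Q +_) κ+aQ≡vR ⟩
      Q + v * Q + v * R             ≡⟨ solve (Q ∷ v ∷ R ∷ []) ⟩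
      Q + v * (Q + R)               ≡⟨ cong (λ y → Q + v * y) (sym P≡Q+R) ⟩
      Q + v * P                     ∎
      where
      regroup₁ : ∀ σ κ ρ a b P → σ + (κ + ρ) + (a + b) * P ≡ (b * P + σ) + (a * P + ρ) + κ
      regroup₁ = solve-∀
      regroup₂ : ∀ a Q v κ → suc a * Q + v * Q + κ ≡ Q + v * Q + (κ + a * Q)
      regroup₂ = solve-∀

    aP+[ρ+Q]≡[1+v]Q : a * P + (ρ + Q) ≡ suc v * Q
    aP+[ρ+Q]≡[1+v]Q = begin-equality
      a * P + (ρ + Q) ≡⟨ sym (+-assoc (a * P) ρ Q) ⟩
      a * P + ρ + Q   ≡⟨ cong (_+ Q) aP+ρ≡vQ ⟩
      v * Q + Q       ≡⟨ +-comm (v * Q) Q ⟩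
      suc v * Q       ∎

    small-remainder : ρ < R → (v ∸ b) ≡⌊ suc v * Q / P ⌋
    small-remainder ρ<R = subst (_≡⌊ suc v * Q / P ⌋) (sym v∸b≡a) (ρ + Q , aP+[ρ+Q]≡[1+v]Q , ρ+Q<P)
      where
      ρ+Q<P : ρ + Q < P
      ρ+Q<P = subst (ρ + Q <_) (trans (+-comm R Q) (sym P≡Q+R)) (+-monoˡ-< Q ρ<R)

      κ+ρ≤Q : κ + ρ ≤ Q
      κ+ρ≤Q = *-cancelʳ-≤ (κ + ρ) Q P (≤-pred (begin
        suc ((κ + ρ) * P)          ≡⟨ cong suc [κ+ρ]P≡ρ[P+Q]+v ⟩
        suc (ρ * (P + Q) + v)      ≡⟨ sym (+-suc (ρ * (P + Q)) v) ⟩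
        ρ * (P + Q) + suc v        ≤⟨ +-monoʳ-≤ (ρ * (P + Q)) v<P+Q ⟩
        ρ * (P + Q) + (P + Q)      ≡⟨ +-comm (ρ * (P + Q)) (P + Q) ⟩
        suc ρ * (P + Q)            ≤⟨ *-monoˡ-≤ (P + Q) ρ<R ⟩
        R * (P + Q)                ≡⟨ R[P+Q]≡QP+1 ⟩
        Q * P + 1                  ≡⟨ +-comm (Q * P) 1 ⟩
        suc (Q * P)                ∎))

      a+b≡v : a + b ≡ v
      a+b≡v = offset-quotient-≡ balance Q<P
        (subst (σ + (κ + ρ) <_) (+-comm P Q) (+-mono-<-≤ σ<P κ+ρ≤Q))

      v∸b≡a : v ∸ b ≡ a
      v∸b≡a = trans (cong (_∸ b) (sym a+b≡v)) (m+n∸n≡m a b)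

    large-remainder : R ≤ ρ → (v ∸ b) ≡⌊ suc v * Q / P ⌋
    large-remainder R≤ρ =
      subst (_≡⌊ suc v * Q / P ⌋) (sym v∸b≡1+a)
            (ρ ∸ R , [1+a]P+[ρ∸R]≡[1+v]Q , ≤-<-trans (m∸n≤m ρ R) ρ<P)
      where
      Q<κ+ρ : Q < κ + ρ
      Q<κ+ρ = *-cancelʳ-< P Q (κ + ρ) (begin-strict
        Q * P           <⟨ m<m+n (Q * P) (s≤s z≤n) ⟩
        Q * P + 1       ≡⟨ sym R[P+Q]≡QP+1 ⟩
        R * (P + Q)     ≤⟨ *-monoˡ-≤ (P + Q) R≤ρ ⟩
        ρ * (P + Q)     ≤⟨ m≤m+n (ρ * (P + Q)) v ⟩
        ρ * (P + Q) + v ≡⟨ sym [κ+ρ]P≡ρ[P+Q]+v ⟩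
        (κ + ρ) * P     ∎)

      κ≤Q : κ ≤ Q
      κ≤Q = ≤-pred (*-cancelʳ-< P κ (suc Q) (begin-strict
        κ * P           ≡⟨ κP≡ρQ+v ⟩
        ρ * Q + v       <⟨ +-monoʳ-< (ρ * Q) v<P+Q ⟩
        ρ * Q + (P + Q) ≡⟨ solve (ρ ∷ Q ∷ P ∷ []) ⟩
        P + suc ρ * Q   ≤⟨ +-monoʳ-≤ P (*-monoˡ-≤ Q ρ<P) ⟩
        P + P * Q       ≡⟨ solve (P ∷ Q ∷ []) ⟩
        suc Q * P       ∎))

      v≡1+a+b : v ≡ suc (a + b)
      v≡1+a+b = offset-quotient-suc balance (<-≤-trans Q<κ+ρ (m≤n+m (κ + ρ) σ)) (begin-strict
        σ + (κ + ρ)   <⟨ +-monoˡ-< (κ + ρ) σ<P ⟩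
        P + (κ + ρ)   <⟨ +-monoʳ-< P (+-mono-≤-< κ≤Q ρ<P) ⟩
        P + (Q + P)   ≡⟨ solve (P ∷ Q ∷ []) ⟩
        Q + (P + P)   ∎)

      v∸b≡1+a : v ∸ b ≡ suc a
      v∸b≡1+a = trans (cong (_∸ b) v≡1+a+b) (m+n∸n≡m (suc a) b)

      [1+a]P+[ρ∸R]≡[1+v]Q : suc a * P + (ρ ∸ R) ≡ suc v * Q
      [1+a]P+[ρ∸R]≡[1+v]Q = begin-equality
        suc a * P + (ρ ∸ R)        ≡⟨ cong (_+ (ρ ∸ R)) (+-comm P (a * P)) ⟩
        a * P + P + (ρ ∸ R)        ≡⟨ +-assoc (a * P) P (ρ ∸ R) ⟩
        a * P + (P + (ρ ∸ R))      ≡⟨ cong (λ y → a * P + (y + (ρ ∸ R))) P≡Q+R ⟩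
        a * P + (Q + R + (ρ ∸ R))  ≡⟨ cong (a * P +_) (+-assoc Q R (ρ ∸ R)) ⟩
        a * P + (Q + (R + (ρ ∸ R))) ≡⟨ cong (λ y → a * P + (Q + y)) (m+[n∸m]≡n R≤ρ) ⟩
        a * P + (Q + ρ)            ≡⟨ cong (a * P +_) (+-comm Q ρ) ⟩
        a * P + (ρ + Q)            ≡⟨ aP+[ρ+Q]≡[1+v]Q ⟩
        suc v * Q                  ∎

  G-step : ∀ {v a b} → v < P + Q → a ≡⌊ v * Q / P ⌋ → b ≡⌊ suc a * Q / P ⌋ →
           (v ∸ b) ≡⌊ suc v * Q / P ⌋
  G-step {v} {a} {b} v<P+Q (ρ , eq , ρ<P) (σ , eq′ , σ<P) with ρ <? R
  ... | yes ρ<R = Step.small-remainder {v} {a} {b} v<P+Q eq ρ<P eq′ σ<P ρ<R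
  ... | no  ρ≮R = Step.large-remainder {v} {a} {b} v<P+Q eq ρ<P eq′ σ<P (≮⇒≥ ρ≮R)

  G-floor : ∀ v → v < P + Q → G v ≡⌊ suc v * Q / P ⌋
  G-floor = <-rec (λ v → v < P + Q → G v ≡⌊ suc v * Q / P ⌋) floor
    where
    floor : ∀ v → (∀ {w} → w < v → w < P + Q → G w ≡⌊ suc w * Q / P ⌋) →
            v < P + Q → G v ≡⌊ suc v * Q / P ⌋
    floor zero          _  _     = Q , sym (+-identityʳ Q) , Q<P
    floor (suc zero)    _  _     = Q ∸ R , P+[Q∸R]≡2Q , ≤-<-trans (m∸n≤m Q R) Q<P
      where
      P+[Q∸R]≡2Q : 1 * P + (Q ∸ R) ≡ 2 * Q
      P+[Q∸R]≡2Q = begin-equality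
        1 * P + (Q ∸ R)   ≡⟨ cong (_+ (Q ∸ R)) (trans (*-identityˡ P) P≡Q+R) ⟩
        Q + R + (Q ∸ R)   ≡⟨ +-assoc Q R (Q ∸ R) ⟩
        Q + (R + (Q ∸ R)) ≡⟨ cong (Q +_) (trans (m+[n∸m]≡n R≤Q) (sym (+-identityʳ Q))) ⟩
        2 * Q             ∎
    floor (suc (suc x)) IH 2+x<P+Q = subst (_≡⌊ suc (suc (suc x)) * Q / P ⌋) (sym (G-suc-suc x))
      (G-step {a = G (suc x)} {b = G (G (suc x))} 2+x<P+Q G[1+x]≡⌊⌋ G[G[1+x]]≡⌊⌋)
      where
      1+x<P+Q : suc x < P + Q
      1+x<P+Q = <-trans (n<1+n (suc x)) 2+x<P+Q
      G[1+x]≡⌊⌋ : G (suc x) ≡⌊ suc (suc x) * Q / P ⌋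
      G[1+x]≡⌊⌋ = IH ≤-refl 1+x<P+Q
      G[G[1+x]]≡⌊⌋ : G (G (suc x)) ≡⌊ suc (G (suc x)) * Q / P ⌋
      G[G[1+x]]≡⌊⌋ = IH (s≤s (G-≤ (suc x))) (≤-<-trans (G-≤ (suc x)) 1+x<P+Q)

  ⌊/⌋⇒G : ∀ {u v} → v < P + Q → u ≡⌊ suc v * Q / P ⌋ → u ≡ G v
  ⌊/⌋⇒G {v = v} v<P+Q u≡⌊⌋ = ⌊/⌋-unique u≡⌊⌋ (G-floor v v<P+Q)

  P≤2Q : P ≤ 2 * Q
  P≤2Q = begin
    P       ≡⟨ P≡Q+R ⟩
    Q + R   ≤⟨ +-monoʳ-≤ Q (≤-trans R≤Q (≤-reflexive (sym (+-identityʳ Q)))) ⟩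
    2 * Q   ∎

  module _ {r : ℕ} .{{_ : NonZero r}} where

    scaled-pair : ∀ {x y c} → y * Q + c ≡ x * P → r * c ≤ Q → 1 ≤ x → 1 ≤ y → r * y + 2 ≤ P + Q →
                  GPairWithResidues r 0 0 (P + Q)
    scaled-pair {x} {y} {c} yQ+c≡xP rc≤Q 1≤x 1≤y ry+2≤P+Q =
      r * x , r * y , (r*-positive 1≤x , r*-positive 1≤y , rx≡G[ry]) ,
      multiple x , multiple y , m+n≤o⇒m≤o∸n (r * y) ry+2≤P+Q
      where
      r*-positive : ∀ {n} → 1 ≤ n → 1 ≤ r * n
      r*-positive = *-mono-≤ (>-nonZero⁻¹ r)
      multiple : ∀ n → (r * n) % r ≡ 0 % r
      multiple n = trans (cong (_% r) (*-comm r n)) ([m+kn]%n≡m%n 0 n r)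
      rxP+[Q∸rc]≡[1+ry]Q : r * x * P + (Q ∸ r * c) ≡ suc (r * y) * Q
      rxP+[Q∸rc]≡[1+ry]Q = +-cancelʳ-≡ (r * c) _ _ (begin-equality
        r * x * P + (Q ∸ r * c) + r * c ≡⟨ +-assoc (r * x * P) (Q ∸ r * c) (r * c) ⟩
        r * x * P + (Q ∸ r * c + r * c) ≡⟨ cong (r * x * P +_) (m∸n+n≡m rc≤Q) ⟩
        r * x * P + Q                   ≡⟨ regroup₁ r x P Q ⟩
        Q + r * (x * P)                 ≡⟨ cong (λ z → Q + r * z) (sym yQ+c≡xP) ⟩
        Q + r * (y * Q + c)             ≡⟨ regroup₂ Q r y c ⟩
        suc (r * y) * Q + r * c         ∎)
        where
        regroup₁ : ∀ r x P Q → r * x * P + Q ≡ Q + r * (x * P)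
        regroup₁ = solve-∀
        regroup₂ : ∀ Q r y c → Q + r * (y * Q + c) ≡ suc (r * y) * Q + r * c
        regroup₂ = solve-∀
      rx≡G[ry] : r * x ≡ G (r * y)
      rx≡G[ry] = ⌊/⌋⇒G (<-≤-trans (m<m+n (r * y) (s≤s z≤n)) ry+2≤P+Q)
        (Q ∸ r * c , rxP+[Q∸rc]≡[1+ry]Q , ≤-<-trans (m∸n≤m Q (r * c)) Q<P)

    quotient-pair : ∀ {M j u s t} → r * M + 1 ≤ P + Q → s < r → t < r → ¬ (s ≡ 0 × t ≡ 0) →
                    j < M → u % r ≡ s % r → u ≡⌊ suc (t + r * j) * Q / P ⌋ →
                    GPairWithResidues r s t (P + Q)
    quotient-pair {M} {j} {u} {s} {t} rM+1≤P+Q s<r t<r ¬s≡0×t≡0 j<M u≡s u≡⌊⌋ =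
      u , v , (1≤u , 1≤v , ⌊/⌋⇒G v<P+Q u≡⌊⌋) , u≡s , v≡t , m+n≤o⇒m≤o∸n v v+2≤P+Q
      where
      v = t + r * j
      v+2≤P+Q : v + 2 ≤ P + Q
      v+2≤P+Q = begin
        t + r * j + 2     ≡⟨ regroup t r j ⟩
        suc t + r * j + 1 ≤⟨ +-monoˡ-≤ 1 (+-monoˡ-≤ (r * j) t<r) ⟩
        r + r * j + 1     ≡⟨ cong (_+ 1) (sym (*-suc r j)) ⟩
        r * suc j + 1     ≤⟨ +-monoˡ-≤ 1 (*-monoʳ-≤ r j<M) ⟩
        r * M + 1         ≤⟨ rM+1≤P+Q ⟩
        P + Q             ∎
        where
        regroup : ∀ t r j → t + r * j + 2 ≡ suc t + r * j + 1
        regroup = solve-∀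
      v<P+Q : v < P + Q
      v<P+Q = <-≤-trans (m<m+n v (s≤s z≤n)) v+2≤P+Q
      v≡t : v % r ≡ t % r
      v≡t = trans (cong (λ n → (t + n) % r) (*-comm r j)) ([m+kn]%n≡m%n t j r)
      1≤v : 1 ≤ v
      1≤v = ≮⇒≥ λ v<1 → ¬s≡0×t≡0 (s≡0 (n<1⇒n≡0 v<1) , m+n≡0⇒m≡0 t (n<1⇒n≡0 v<1))
        where
        s≡0 : v ≡ 0 → s ≡ 0
        s≡0 v≡0 = begin-equality
          s       ≡⟨ sym (m<n⇒m%n≡m s<r) ⟩
          s % r   ≡⟨ sym u≡s ⟩
          u % r   ≡⟨ cong (_% r) (⌊/⌋-unique u≡⌊⌋ (Q , Q≡[1+v]Q , Q<P)) ⟩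
          0 % r   ≡⟨ m<n⇒m%n≡m (>-nonZero⁻¹ r) ⟩
          0       ∎
          where
          Q≡[1+v]Q : 0 * P + Q ≡ suc v * Q
          Q≡[1+v]Q = trans (sym (+-identityʳ Q)) (cong (λ n → suc n * Q) (sym v≡0))
      1≤u : 1 ≤ u
      1≤u = ⌊/⌋-positive u≡⌊⌋ (≤-trans P≤2Q (*-monoˡ-≤ Q (s≤s 1≤v)))

    nonzero-pair : ∀ {M w s t} → WindowCover P Q M w → r * w ≤ P → r * M + 1 ≤ P + Q →
                   s < r → t < r → ¬ (s ≡ 0 × t ≡ 0) → GPairWithResidues r s t (P + Q)
    nonzero-pair cover rw≤P rM+1≤P+Q s<r t<r ¬s≡0×t≡0 =
      let j , j<M , u , u≡s , u≡⌊⌋ = lift-residue cover (<⇒≤ Q<P) rw≤P s<r t<r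
      in quotient-pair rM+1≤P+Q s<r t<r ¬s≡0×t≡0 j<M u≡s u≡⌊⌋

    residue-pair : ∀ {M w s t} → WindowCover P Q M w → r * w ≤ P → r * M + 1 ≤ P + Q →
                   GPairWithResidues r 0 0 (P + Q) → s < r → t < r → GPairWithResidues r s t (P + Q)
    residue-pair {s = s} {t} cover rw≤P rM+1≤P+Q pair₀₀ s<r t<r with s ≟ 0 | t ≟ 0
    ... | yes refl | yes refl = pair₀₀
    ... | no s≢0   | _        = nonzero-pair cover rw≤P rM+1≤P+Q s<r t<r (s≢0 ∘ proj₁)
    ... | yes _    | no t≢0   = nonzero-pair cover rw≤P rM+1≤P+Q s<r t<r (t≢0 ∘ proj₂)

F-suc-+ : ∀ m n → F (suc (m + n)) ≡ F (suc m) * F (suc n) + F m * F n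
F-suc-+ zero    n = sym (trans (+-identityʳ _) (*-identityˡ _))
F-suc-+ (suc m) n = begin-equality
  F (suc (suc (m + n)))                           ≡⟨ cong (λ i → F (suc i)) (sym (+-suc m n)) ⟩
  F (suc (m + suc n))                             ≡⟨ F-suc-+ m (suc n) ⟩
  F (suc m) * (F (suc n) + F n) + F m * F (suc n) ≡⟨ regroup (F (suc m)) (F m) (F (suc n)) (F n) ⟩
  (F (suc m) + F m) * F (suc n) + F (suc m) * F n ∎
  where
  regroup : ∀ x y u w → x * (u + w) + y * u ≡ (x + y) * u + x * w
  regroup = solve-∀

cassini-step₊ : ∀ {a p} → (p + a) * a + 1 ≡ p * p → (p + a + p) * p ≡ (p + a) * (p + a) + 1
cassini-step₊ {a} {p} c = +-cancelʳ-≡ (p * p) _ _ (begin-equality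
  (p + a + p) * p + p * p             ≡⟨ cong ((p + a + p) * p +_) (sym c) ⟩
  (p + a + p) * p + ((p + a) * a + 1) ≡⟨ regroup a p ⟩
  (p + a) * (p + a) + 1 + p * p       ∎)
  where
  regroup : ∀ a p → (p + a + p) * p + ((p + a) * a + 1) ≡ (p + a) * (p + a) + 1 + p * p
  regroup = solve-∀

cassini-step₋ : ∀ {a p} → (p + a) * a ≡ p * p + 1 → (p + a + p) * p + 1 ≡ (p + a) * (p + a)
cassini-step₋ {a} {p} c = +-cancelʳ-≡ (p * p) _ _ (begin-equality
  (p + a + p) * p + 1 + p * p       ≡⟨ regroup₁ a p ⟩
  (p + a + p) * p + (p * p + 1)     ≡⟨ cong ((p + a + p) * p +_) (sym c) ⟩
  (p + a + p) * p + (p + a) * a     ≡⟨ regroup₂ a p ⟩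
  (p + a) * (p + a) + p * p         ∎)
  where
  regroup₁ : ∀ a p → (p + a + p) * p + 1 + p * p ≡ (p + a + p) * p + (p * p + 1)
  regroup₁ = solve-∀
  regroup₂ : ∀ a p → (p + a + p) * p + (p + a) * a ≡ (p + a) * (p + a) + p * p
  regroup₂ = solve-∀

cassini : ∀ k → F (suc (suc k)) * F k + 1 ≡ F (suc k) * F (suc k)
              ⊎ F (suc (suc k)) * F k ≡ F (suc k) * F (suc k) + 1
cassini zero    = inj₁ refl
cassini (suc k) with cassini k
... | inj₁ c = inj₂ (cassini-step₊ {F k} {F (suc k)} c)
... | inj₂ c = inj₁ (cassini-step₋ {F k} {F (suc k)} c)

F-pos : ∀ k → 1 ≤ F (suc k)
F-pos zero    = ≤-refl
F-pos (suc k) = ≤-trans (F-pos k) (m≤m+n (F (suc k)) (F k))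

F-≤-suc : ∀ k → F k ≤ F (suc k)
F-≤-suc zero    = z≤n
F-≤-suc (suc k) = m≤m+n (F (suc k)) (F k)

-- A = B + (X − M)²
cancel-adjacent-squares : ∀ A B X M → X + 1 ≡ M ⊎ X ≡ M + 1 →
                          A + 2 * M * X ≡ B + X * X + M * M → B + 1 ≡ A
cancel-adjacent-squares A B X .(X + 1) (inj₁ refl) eq =
  +-cancelʳ-≡ (2 * (X + 1) * X) (B + 1) A (trans (expand B X) (sym eq))
  where
  expand : ∀ B X → B + 1 + 2 * (X + 1) * X ≡ B + X * X + (X + 1) * (X + 1)
  expand = solve-∀
cancel-adjacent-squares A B .(M + 1) M (inj₂ refl) eq =
  +-cancelʳ-≡ (2 * M * (M + 1)) (B + 1) A (trans (expand B M) (sym eq))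
  where
  expand : ∀ B M → B + 1 + 2 * M * (M + 1) ≡ B + (M + 1) * (M + 1) + M * M
  expand = solve-∀

+-*-cancelʳ-≡ : ∀ {A B} c {U V} → U ≡ V → A + c * U ≡ B + c * V → A ≡ B
+-*-cancelʳ-≡ c {U} refl = +-cancelʳ-≡ (c * U) _ _

-- For (a, p, q) = (F k, F (k + 1), F (k + 2)):  P = F (2k + 3), Q = F (2k + 2),
-- R = F (2k + 1), L is the Lucas number F k + F (k + 2), and Cassini reads X = p² ∓ 1.
module Doubling (a p : ℕ) where

  q L P Q R X : ℕ
  q = p + a
  L = p + 2 * a
  P = q * q + p * p
  Q = p * L
  R = p * p + a * a
  X = q * a

  P≡Q+R : P ≡ Q + R
  P≡Q+R = identity a p
    where
    identity : ∀ a p → (p + a) * (p + a) + p * p ≡ p * (p + 2 * a) + (p * p + a * a)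
    identity = solve-∀

  cassini-doubled : X + 1 ≡ p * p ⊎ X ≡ p * p + 1 → Q * Q + 1 ≡ P * R
  cassini-doubled sign = cancel-adjacent-squares (P * R) (Q * Q) X (p * p) sign (identity a p)
    where
    identity : ∀ a p → ((p + a) * (p + a) + p * p) * (p * p + a * a) + 2 * (p * p) * ((p + a) * a)
                     ≡ p * (p + 2 * a) * (p * (p + 2 * a)) + (p + a) * a * ((p + a) * a) + p * p * (p * p)
    identity = solve-∀

  L²≡p²+4X : L * L ≡ p * p + 4 * X
  L²≡p²+4X = identity a p
    where
    identity : ∀ a p → (p + 2 * a) * (p + 2 * a) ≡ p * p + 4 * ((p + a) * a)
    identity = solve-∀

  Lq≡q²+X : L * q ≡ q * q + X
  Lq≡q²+X = identity a p
    where
    identity : ∀ a p → (p + 2 * a) * (p + a) ≡ (p + a) * (p + a) + (p + a) * a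
    identity = solve-∀

  L[p+q]+p²≡P+Q+X : L * (p + q) + p * p ≡ P + Q + X
  L[p+q]+p²≡P+Q+X = identity a p
    where
    identity : ∀ a p → (p + 2 * a) * (p + (p + a)) + p * p
                     ≡ (p + a) * (p + a) + p * p + p * (p + 2 * a) + (p + a) * a
    identity = solve-∀

  pQ+q[X+1]≡q+aP+qp² : p * Q + q * (X + 1) ≡ q + a * P + q * (p * p)
  pQ+q[X+1]≡q+aP+qp² = identity a p
    where
    identity : ∀ a p → p * (p * (p + 2 * a)) + (p + a) * ((p + a) * a + 1)
                     ≡ p + a + a * ((p + a) * (p + a) + p * p) + (p + a) * (p * p)
    identity = solve-∀

  qQ+p+pp²≡pP+p[X+1] : q * Q + p + p * (p * p) ≡ p * P + p * (X + 1)
  qQ+p+pp²≡pP+p[X+1] = identity a p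
    where
    identity : ∀ a p → (p + a) * (p * (p + 2 * a)) + p + p * (p * p)
                     ≡ p * ((p + a) * (p + a) + p * p) + p * ((p + a) * a + 1)
    identity = solve-∀

  pQ+q+qX≡aP+q[p²+1] : p * Q + q + q * X ≡ a * P + q * (p * p + 1)
  pQ+q+qX≡aP+q[p²+1] = identity a p
    where
    identity : ∀ a p → p * (p * (p + 2 * a)) + (p + a) + (p + a) * ((p + a) * a)
                     ≡ a * ((p + a) * (p + a) + p * p) + (p + a) * (p * p + 1)
    identity = solve-∀

  qQ+p[p²+1]≡pP+p+pX : q * Q + p * (p * p + 1) ≡ p * P + p + p * X
  qQ+p[p²+1]≡pP+p+pX = identity a p
    where
    identity : ∀ a p → (p + a) * (p * (p + 2 * a)) + p * (p * p + 1)
                     ≡ p * ((p + a) * (p + a) + p * p) + p + p * ((p + a) * a)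
    identity = solve-∀

  [p+q]Q+a+aX≡qP+a[p²+1] : (p + q) * Q + a + a * X ≡ q * P + a * (p * p + 1)
  [p+q]Q+a+aX≡qP+a[p²+1] = identity a p
    where
    identity : ∀ a p → (p + (p + a)) * (p * (p + 2 * a)) + a + a * ((p + a) * a)
                     ≡ (p + a) * ((p + a) * (p + a) + p * p) + a * (p * p + 1)
    identity = solve-∀

  pq+ap≡Q : p * q + a * p ≡ Q
  pq+ap≡Q = identity a p
    where
    identity : ∀ a p → p * (p + a) + a * p ≡ p * (p + 2 * a)
    identity = solve-∀

  bound₊ : ∀ {r} → X + 1 ≡ p * p → (2 * r ∸ L) * (2 * r ∸ L) < 5 * (p * p) → r ≤ L
  bound₊ {r} c d²<5p² = ≮⇒≥ λ L<r → <-irrefl refl (begin-strict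
    5 * (p * p)         ≡⟨ 5p²≡L²+4 ⟩
    L * L + 4           ≤⟨ m≤m+n (L * L + 4) (4 * L) ⟩
    L * L + 4 + 4 * L   ≡⟨ square L ⟩
    (L + 2) * (L + 2)   ≤⟨ *-mono-≤ (L+2≤d L<r) (L+2≤d L<r) ⟩
    (2 * r ∸ L) * (2 * r ∸ L) <⟨ d²<5p² ⟩
    5 * (p * p)         ∎)
    where
    square : ∀ L → L * L + 4 + 4 * L ≡ (L + 2) * (L + 2)
    square = solve-∀
    regroup₁ : ∀ m → 5 * m ≡ m + 4 * m
    regroup₁ = solve-∀
    regroup₂ : ∀ m x → m + 4 * (x + 1) ≡ m + 4 * x + 4
    regroup₂ = solve-∀
    regroup₃ : ∀ L → L + (L + 2) ≡ 2 * suc L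
    regroup₃ = solve-∀
    5p²≡L²+4 : 5 * (p * p) ≡ L * L + 4
    5p²≡L²+4 = begin-equality
      5 * (p * p)             ≡⟨ regroup₁ (p * p) ⟩
      p * p + 4 * (p * p)     ≡⟨ cong (λ y → p * p + 4 * y) (sym c) ⟩
      p * p + 4 * (X + 1)     ≡⟨ regroup₂ (p * p) X ⟩
      p * p + 4 * X + 4       ≡⟨ cong (_+ 4) (sym L²≡p²+4X) ⟩
      L * L + 4               ∎
    L+2≤d : L < r → L + 2 ≤ 2 * r ∸ L
    L+2≤d L<r = begin
      L + 2             ≡⟨ sym (m+n∸m≡n L (L + 2)) ⟩
      L + (L + 2) ∸ L   ≡⟨ cong (_∸ L) (regroup₃ L) ⟩
      2 * suc L ∸ L     ≤⟨ ∸-monoˡ-≤ L (*-monoʳ-≤ 2 L<r) ⟩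
      2 * r ∸ L         ∎

  bound₋ : ∀ {r} → X ≡ p * p + 1 → (2 * r ∸ L) * (2 * r ∸ L) < 5 * (p * p) → r < L
  bound₋ {r} c d²<5p² = ≰⇒> λ L≤r → <-irrefl refl (begin-strict
    5 * (p * p)               <⟨ m<m+n (5 * (p * p)) (s≤s z≤n) ⟩
    5 * (p * p) + 4           ≡⟨ 5p²+4≡L² ⟩
    L * L                     ≤⟨ *-mono-≤ (L≤d L≤r) (L≤d L≤r) ⟩
    (2 * r ∸ L) * (2 * r ∸ L) <⟨ d²<5p² ⟩
    5 * (p * p)               ∎)
    where
    regroup₁ : ∀ m → 5 * m + 4 ≡ m + 4 * (m + 1)
    regroup₁ = solve-∀
    regroup₂ : ∀ L → L + L ≡ 2 * L
    regroup₂ = solve-∀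
    5p²+4≡L² : 5 * (p * p) + 4 ≡ L * L
    5p²+4≡L² = begin-equality
      5 * (p * p) + 4         ≡⟨ regroup₁ (p * p) ⟩
      p * p + 4 * (p * p + 1) ≡⟨ cong (λ y → p * p + 4 * y) (sym c) ⟩
      p * p + 4 * X           ≡⟨ sym L²≡p²+4X ⟩
      L * L                   ∎
    L≤d : L ≤ r → L ≤ 2 * r ∸ L
    L≤d L≤r = begin
      L             ≡⟨ sym (m+n∸m≡n L L) ⟩
      L + L ∸ L     ≡⟨ cong (_∸ L) (regroup₂ L) ⟩
      2 * L ∸ L     ≤⟨ ∸-monoˡ-≤ L (*-monoʳ-≤ 2 L≤r) ⟩
      2 * r ∸ L     ∎

  module _ (1≤p : 1 ≤ p) (a≤p : a ≤ p) {r : ℕ} .{{_ : NonZero r}} where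

    p≤q : p ≤ q
    p≤q = m≤m+n p a

    1≤q : 1 ≤ q
    1≤q = ≤-trans 1≤p p≤q

    R≤Q : R ≤ Q
    R≤Q = subst (R ≤_) pq+ap≡Q (+-mono-≤ (*-monoʳ-≤ p p≤q) (*-monoʳ-≤ a a≤p))

    1≤R : 1 ≤ R
    1≤R = ≤-trans (*-mono-≤ 1≤p 1≤p) (m≤m+n (p * p) (a * a))

    instance
      P-nonZero : NonZero P
      P-nonZero = >-nonZero (≤-trans (*-mono-≤ 1≤p 1≤p) (m≤n+m (p * p) (q * q)))

    pairs₊ : ∀ {s t} → X + 1 ≡ p * p → r ≤ L → s < r → t < r → GPairWithResidues r s t (P + Q)
    pairs₊ c r≤L s<r t<r = residue-pair (window-cover₊ pQ≈q qQ+p≈0) rq≤P r[p+q]+1≤P+Q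
                                        (scaled-pair qQ+p≡pP rp≤Q 1≤p 1≤q rq+2≤P+Q) s<r t<r
      where
      open CassiniTriple P≡Q+R (cassini-doubled (inj₁ c)) R≤Q 1≤R using (residue-pair; scaled-pair)
      open Walk Q p q 1≤p p≤q
      pQ≡q+aP : p * Q ≡ q + a * P
      pQ≡q+aP = +-*-cancelʳ-≡ q c pQ+q[X+1]≡q+aP+qp²
      qQ+p≡pP : q * Q + p ≡ p * P
      qQ+p≡pP = +-*-cancelʳ-≡ p (sym c) qQ+p+pp²≡pP+p[X+1]
      pQ≈q : p * Q ≈ q
      pQ≈q = trans (cong (_% P) pQ≡q+aP) ([m+kn]%n≡m%n q a P)
      qQ+p≈0 : q * Q + p ≈ 0
      qQ+p≈0 = trans (cong (_% P) qQ+p≡pP) ([m+kn]%n≡m%n 0 p P)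
      rq≤P : r * q ≤ P
      rq≤P = begin
        r * q           ≤⟨ *-monoˡ-≤ q r≤L ⟩
        L * q           ≡⟨ Lq≡q²+X ⟩
        q * q + X       ≤⟨ +-monoʳ-≤ (q * q) (m≤m+n X 1) ⟩
        q * q + (X + 1) ≡⟨ cong (q * q +_) c ⟩
        P               ∎
      L[p+q]+1≡P+Q : L * (p + q) + 1 ≡ P + Q
      L[p+q]+1≡P+Q = +-cancelʳ-≡ X _ _ (begin-equality
        L * (p + q) + 1 + X     ≡⟨ +-assoc (L * (p + q)) 1 X ⟩
        L * (p + q) + (1 + X)   ≡⟨ cong (L * (p + q) +_) (trans (+-comm 1 X) c) ⟩
        L * (p + q) + p * p     ≡⟨ L[p+q]+p²≡P+Q+X ⟩
        P + Q + X               ∎)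
      r[p+q]+1≤P+Q : r * (p + q) + 1 ≤ P + Q
      r[p+q]+1≤P+Q = ≤-trans (+-monoˡ-≤ 1 (*-monoˡ-≤ (p + q) r≤L)) (≤-reflexive L[p+q]+1≡P+Q)
      rp≤Q : r * p ≤ Q
      rp≤Q = ≤-trans (*-monoˡ-≤ p r≤L) (≤-reflexive (*-comm L p))
      rq+2≤P+Q : r * q + 2 ≤ P + Q
      rq+2≤P+Q = begin
        r * q + (1 + 1)       ≤⟨ +-monoʳ-≤ (r * q) (+-monoʳ-≤ 1 (*-mono-≤ (>-nonZero⁻¹ r) 1≤p)) ⟩
        r * q + (1 + r * p)   ≡⟨ regroup r p q ⟩
        r * (p + q) + 1       ≤⟨ r[p+q]+1≤P+Q ⟩
        P + Q                 ∎
        where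
        regroup : ∀ r p q → r * q + (1 + r * p) ≡ r * (p + q) + 1
        regroup = solve-∀

    pairs₋ : ∀ {s t} → X ≡ p * p + 1 → r < L → s < r → t < r → GPairWithResidues r s t (P + Q)
    pairs₋ c r<L s<r t<r = residue-pair (window-cover₋ pQ+q≈0 qQ≈p) rq≤P r[p+q]+1≤P+Q
                                        (scaled-pair [p+q]Q+a≡qP ra≤Q 1≤q 1≤p+q r[p+q]+2≤P+Q) s<r t<r
      where
      open CassiniTriple P≡Q+R (cassini-doubled (inj₂ c)) R≤Q 1≤R using (residue-pair; scaled-pair)
      open Walk Q p q 1≤p p≤q
      pQ+q≡aP : p * Q + q ≡ a * P
      pQ+q≡aP = +-*-cancelʳ-≡ q c pQ+q+qX≡aP+q[p²+1]
      qQ≡pP+p : q * Q ≡ p * P + p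
      qQ≡pP+p = +-*-cancelʳ-≡ p (sym c) qQ+p[p²+1]≡pP+p+pX
      [p+q]Q+a≡qP : (p + q) * Q + a ≡ q * P
      [p+q]Q+a≡qP = +-*-cancelʳ-≡ a c [p+q]Q+a+aX≡qP+a[p²+1]
      pQ+q≈0 : p * Q + q ≈ 0
      pQ+q≈0 = trans (cong (_% P) pQ+q≡aP) ([m+kn]%n≡m%n 0 a P)
      qQ≈p : q * Q ≈ p
      qQ≈p = trans (cong (_% P) (trans qQ≡pP+p (+-comm (p * P) p))) ([m+kn]%n≡m%n p p P)
      1≤a : 1 ≤ a
      1≤a = ≮⇒≥ λ a<1 → 0≢1+n (begin-equality
        0               ≡⟨ sym (*-zeroʳ q) ⟩
        q * 0           ≡⟨ cong (q *_) (sym (n<1⇒n≡0 a<1)) ⟩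
        X               ≡⟨ c ⟩
        p * p + 1       ≡⟨ +-comm (p * p) 1 ⟩
        suc (p * p)     ∎)
      1≤p+q : 1 ≤ p + q
      1≤p+q = ≤-trans 1≤q (m≤n+m q p)
      rq≤P : r * q ≤ P
      rq≤P = +-cancelʳ-≤ 1 (r * q) P (begin
        r * q + 1           ≤⟨ +-monoʳ-≤ (r * q) 1≤q ⟩
        r * q + q           ≡⟨ +-comm (r * q) q ⟩
        suc r * q           ≤⟨ *-monoˡ-≤ q r<L ⟩
        L * q               ≡⟨ Lq≡q²+X ⟩
        q * q + X           ≡⟨ cong (q * q +_) c ⟩
        q * q + (p * p + 1) ≡⟨ sym (+-assoc (q * q) (p * p) 1) ⟩
        P + 1               ∎)
      L[p+q]≡P+Q+1 : L * (p + q) ≡ P + Q + 1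
      L[p+q]≡P+Q+1 = +-cancelʳ-≡ (p * p) _ _ (begin-equality
        L * (p + q) + p * p   ≡⟨ L[p+q]+p²≡P+Q+X ⟩
        P + Q + X             ≡⟨ cong (P + Q +_) c ⟩
        P + Q + (p * p + 1)   ≡⟨ regroup (P + Q) (p * p) ⟩
        P + Q + 1 + p * p     ∎)
        where
        regroup : ∀ n m → n + (m + 1) ≡ n + 1 + m
        regroup = solve-∀
      r[p+q]+2≤P+Q : r * (p + q) + 2 ≤ P + Q
      r[p+q]+2≤P+Q = +-cancelʳ-≤ 1 _ _ (begin
        r * (p + q) + 2 + 1   ≡⟨ +-assoc (r * (p + q)) 2 1 ⟩
        r * (p + q) + 3       ≤⟨ +-monoʳ-≤ (r * (p + q)) (+-mono-≤ 1≤p (+-mono-≤ 1≤p 1≤a)) ⟩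
        r * (p + q) + (p + q) ≡⟨ +-comm (r * (p + q)) (p + q) ⟩
        suc r * (p + q)       ≤⟨ *-monoˡ-≤ (p + q) r<L ⟩
        L * (p + q)           ≡⟨ L[p+q]≡P+Q+1 ⟩
        P + Q + 1             ∎)
      r[p+q]+1≤P+Q : r * (p + q) + 1 ≤ P + Q
      r[p+q]+1≤P+Q = ≤-trans (+-monoʳ-≤ (r * (p + q)) (s≤s z≤n)) r[p+q]+2≤P+Q
      ra≤Q : r * a ≤ Q
      ra≤Q = ≤-trans (*-mono-≤ (<⇒≤ r<L) a≤p) (≤-reflexive (*-comm L p))

F-double : ∀ k → F (2 * suc k + 2) ≡ Doubling.P (F k) (F (suc k)) + Doubling.Q (F k) (F (suc k))
F-double k = begin-equality
  F (2 * suc k + 2)                                           ≡⟨ cong F (index k) ⟩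
  F (suc (suc k + suc (suc k)))                               ≡⟨ F-suc-+ (suc k) (suc (suc k)) ⟩
  F (suc (suc k)) * F (suc (suc (suc k))) + F (suc k) * F (suc (suc k)) ≡⟨ identity (F k) (F (suc k)) ⟩
  Doubling.P (F k) (F (suc k)) + Doubling.Q (F k) (F (suc k)) ∎
  where
  index : ∀ k → 2 * suc k + 2 ≡ suc (suc k + suc (suc k))
  index = solve-∀
  identity : ∀ a p → (p + a) * (p + a + p) + p * (p + a) ≡ (p + a) * (p + a) + p * p + p * (p + 2 * a)
  identity = solve-∀

theorem2 : (r s t h : ℕ) → .{{_ : NonZero r}} → s < r → t < r → 1 ≤ h → LtPhiPow r h →
    Σ ℕ (λ u → Σ ℕ (λ v → GPair u v × (u % r ≡ s % r) × (v % r ≡ t % r) × (v ≤ F (2 * h + 2) ∸ 2)))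
theorem2 r s t zero    s<r t<r ()  _
theorem2 r s t (suc k) s<r t<r _ r<φ^h = subst (GPairWithResidues r s t) (sym (F-double k))
  ([ (λ c → pairs₊ (F-pos k) (F-≤-suc k) c (bound₊ c r<φ^h) s<r t<r)
   , (λ c → pairs₋ (F-pos k) (F-≤-suc k) c (bound₋ c r<φ^h) s<r t<r)
   ]′ (cassini k))
  where
  open Doubling (F k) (F (suc k))
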